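{- Let $G$ be a graph containing the complete bipartite graph $K_{p,q}$ as a subgraph, where $(p,q)\notin\{(1,1),(1,2),(2,1),(2,2)\}$. Then $Z(G)\ge \min\{p,q\}+1$.
   Context: All graphs are finite, simple and undirected. Zero forcing: vertices are coloured black or white; if a black vertex $u$ has exactly one white neighbour $v$, then $v$ is recoloured black. A set $Z\subseteq V(G)$ is a zero forcing set if, starting with $Z$ black and all other vertices white, repeated application of this rule colours all vertices black; $Z(G)$ is the minimum size of a zero forcing set. "Subgraph" means not necessarily induced. -}

module Defs where

open import Data.Nat using (ℕ; _≤_; _+_; suc)
open import Data.Nat.Base using (_⊓_)
open import Data.Fin using (Fin)
open import Data.Fin.Subset using (Subset; _∈_; ∣_∣)
open import Data.Bool using (Bool; true; false)
open import Data.Product using (Σ; _×_; ∃)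
open import Relation.Binary.PropositionalEquality using (_≡_; _≢_)
open import Relation.Nullary using (¬_)
open import Function.Definitions using (Injective)

record Graph (n : ℕ) : Set where
  field
    adj   : Fin n → Fin n → Bool
    sym   : ∀ u v → adj u v ≡ adj v u
    irrefl : ∀ v → adj v v ≡ false
open Graph public

-- Vertices that become black starting from Z (the closure of the colour-change rule).
-- v becomes black if it is in Z, or some black vertex u adjacent to v has all its
-- other neighbours black (so v is u's unique white neighbour at that point).
data Black {n : ℕ} (G : Graph n) (Z : Subset n) : Fin n → Set where
  init  : ∀ {v} → v ∈ Z → Black G Z v
  force : ∀ {u v} → Black G Z u → adj G u v ≡ true →
          (∀ w → adj G u w ≡ true → w ≢ v → Black G Z w) → Black G Z v

IsZeroForcingSet : {n : ℕ} → Graph n → Subset n → Set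
IsZeroForcingSet G Z = ∀ v → Black G Z v

ZeroForcingNumber≥ : {n : ℕ} → Graph n → ℕ → Set
ZeroForcingNumber≥ G k = ∀ Z → IsZeroForcingSet G Z → k ≤ ∣ Z ∣

-- G contains K_{p,q} as a (not necessarily induced) subgraph.
ContainsKpq : {n : ℕ} → Graph n → ℕ → ℕ → Set
ContainsKpq {n} G p q =
  Σ (Fin p → Fin n) λ f → Σ (Fin q → Fin n) λ g →
    Injective _≡_ _≡_ f × Injective _≡_ _≡_ g ×
    (∀ i j → f i ≢ g j) × (∀ i j → adj G (f i) (g j) ≡ true)

Excluded : ℕ → ℕ → Set
Excluded p q = p ≤ 2 × q ≤ 2

module Submission where

-- Let Z be a zero forcing set with |Z| ≤ min(p,q) and let L, R be
-- the two sides of the biclique.  Follow the forcing process one force at a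
-- time.  Every vertex of Z starts a forcing chain, and a black vertex with a
-- white neighbour ("active") must be the current end of its chain, so at most
-- |Z| vertices are ever active at once.  While both sides keep a white vertex
-- we force; as long as each side has at most one white vertex, the other
-- vertices of K_{p,q} are all active, i.e. (p-1)+(q-1) ≤ |Z|, which forces
-- p, q ≤ 2.  Otherwise some side, say L, has two white vertices.  Once the
-- other side R is entirely black the process is stuck: a vertex of R has two
-- white neighbours, so the next forcing vertex lies outside R, and it
-- together with R gives q+1 > |Z| active vertices.  At the very start the
-- same counts apply to the vertices of Z instead of the active ones.

open import Defs
open import Data.Nat using (ℕ; _≤_; _⊓_; suc; _+_)
open import Relation.Nullary using (¬_)

open import Data.Nat using (z≤n; s≤s; _≤?_)
import Data.Nat.Properties as ℕₚ
open import Data.Fin using (Fin; zero; suc; splitAt; join; punchIn; _≟_)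
import Data.Fin.Properties as Finₚ
open import Data.Fin.Subset using (Subset; _∈_; _∉_; _⊆_; _⊂_; _⊃_; ∣_∣; _∪_; ⁅_⁆; inside; outside)
open import Data.Fin.Subset.Properties using (_∈?_; p⊆p∪q; q⊆p∪q; x∈p∪q⁻; x∈⁅x⁆; x∈⁅y⁆⇒x≡y)
open import Data.Fin.Subset.Induction using (Acc; acc; ⊃-wellFounded)
open import Data.Vec.Base using ([]; _∷_; here; there)
open import Data.Vec.Functional as Vector using (Vector; _++_; removeAt; updateAt)
open import Data.Vec.Functional.Properties using (updateAt-updates; updateAt-minimal)
open import Data.Bool using (true)
open import Data.Bool.Properties using () renaming (_≟_ to _≟ᵇ_)
open import Data.Product using (Σ; ∃; ∃₂; _×_; _,_; proj₁; proj₂)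
open import Data.Sum using (_⊎_; inj₁; inj₂; [_,_])
open import Data.Empty using (⊥; ⊥-elim)
open import Function using (_∘_; const)
open import Function.Definitions using (Injective)
open import Relation.Nullary using (yes; no)
open import Relation.Nullary.Decidable using (_×-dec_; ¬?; decidable-stable)
open import Relation.Unary using (Decidable)
open import Relation.Binary.PropositionalEquality
  using (_≡_; _≢_; refl; trans; cong; subst; module ≡-Reasoning)
  renaming (sym to ≡-sym)

+-≤-suc⇒≤1 : ∀ m n → m + n ≤ suc m → n ≤ 1
+-≤-suc⇒≤1 m n h = ℕₚ.+-cancelˡ-≤ m n 1 (subst (m + n ≤_) (ℕₚ.+-comm 1 m) h)

_occursIn_ : {X : Set} {k : ℕ} → X → Vector X k → Set
x occursIn α = ∃ λ i → α i ≡ x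

injective-occurring-≤ : {X : Set} {r k : ℕ} (α : Vector X k) (β : Vector X r) →
  Injective _≡_ _≡_ β → (∀ j → β j occursIn α) → r ≤ k
injective-occurring-≤ {r = r} {k} α β β-injective occurs =
  Finₚ.injective⇒≤ position-injective
  where
    position : Fin r → Fin k
    position j = proj₁ (occurs j)

    position-injective : Injective _≡_ _≡_ position
    position-injective {i} {j} same = β-injective (begin
      β i            ≡⟨ ≡-sym (proj₂ (occurs i)) ⟩
      α (position i) ≡⟨ cong α same ⟩
      α (position j) ≡⟨ proj₂ (occurs j) ⟩
      β j            ∎)
      where open ≡-Reasoning

++-injective : {X : Set} {r s : ℕ} (β : Vector X r) (γ : Vector X s) →
  Injective _≡_ _≡_ β → Injective _≡_ _≡_ γ → (∀ i j → β i ≢ γ j) →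
  Injective _≡_ _≡_ (β ++ γ)
++-injective {r = r} {s} β γ β-injective γ-injective apart {x} {y} same = begin
  x                       ≡⟨ ≡-sym (Finₚ.join-splitAt r s x) ⟩
  join r s (splitAt r x)  ≡⟨ cong (join r s) (halves (splitAt r x) (splitAt r y) same) ⟩
  join r s (splitAt r y)  ≡⟨ Finₚ.join-splitAt r s y ⟩
  y                       ∎
  where
    open ≡-Reasoning
    halves : (a b : Fin r ⊎ Fin s) → [ β , γ ] a ≡ [ β , γ ] b → a ≡ b
    halves (inj₁ i) (inj₁ j) e = cong inj₁ (β-injective e)
    halves (inj₁ i) (inj₂ j) e = ⊥-elim (apart i j e)
    halves (inj₂ i) (inj₁ j) e = ⊥-elim (apart j i (≡-sym e))
    halves (inj₂ i) (inj₂ j) e = cong inj₂ (γ-injective e)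

++-all : {X : Set} {P : X → Set} {r s : ℕ} (β : Vector X r) (γ : Vector X s) →
  (∀ i → P (β i)) → (∀ j → P (γ j)) → ∀ k → P ((β ++ γ) k)
++-all {r = r} β γ Pβ Pγ k with splitAt r k
... | inj₁ i = Pβ i
... | inj₂ j = Pγ j

∷-injective : {X : Set} {r : ℕ} (x : X) (β : Vector X r) →
  Injective _≡_ _≡_ β → (∀ i → β i ≢ x) → Injective _≡_ _≡_ (x Vector.∷ β)
∷-injective x β β-injective fresh {zero}  {zero}  _ = refl
∷-injective x β β-injective fresh {zero}  {suc j} e = ⊥-elim (fresh j (≡-sym e))
∷-injective x β β-injective fresh {suc i} {zero}  e = ⊥-elim (fresh i e)
∷-injective x β β-injective fresh {suc i} {suc j} e = cong suc (β-injective e)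

removeAt-injective : {X : Set} {r : ℕ} (β : Vector X (suc r)) →
  Injective _≡_ _≡_ β → ∀ a → Injective _≡_ _≡_ (removeAt β a)
removeAt-injective β β-injective a e = Finₚ.punchIn-injective a _ _ (β-injective e)

failureOrAll : {m : ℕ} {P : Fin m → Set} → Decidable P →
  (∃ λ i → ¬ P i) ⊎ (∀ i → P i)
failureOrAll {m} {P} P? with Finₚ.all? P?
... | yes all = inj₂ all
... | no notAll = inj₁ (Finₚ.¬∀⟶∃¬ m P P? notAll)

twoFailuresOrAllButOne : {m : ℕ} {P : Fin (suc m) → Set} → Decidable P →
  (∃₂ λ a b → a ≢ b × ¬ P a × ¬ P b) ⊎ (∃ λ a → ∀ i → P (punchIn a i))
twoFailuresOrAllButOne P? with failureOrAll P?
... | inj₂ all = inj₂ (zero , λ i → all (punchIn zero i))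
... | inj₁ (a , ¬Pa) with failureOrAll (P? ∘ punchIn a)
...   | inj₁ (i , ¬Pi) = inj₁ (a , punchIn a i , (λ e → Finₚ.punchInᵢ≢i a i (≡-sym e)) , ¬Pa , ¬Pi)
...   | inj₂ rest = inj₂ (a , rest)

enumerate : {n : ℕ} (P : Subset n) →
  Σ (Vector (Fin n) ∣ P ∣) λ α → ∀ {x} → x ∈ P → x occursIn α
enumerate [] = (λ ()) , λ ()
enumerate (inside ∷ P) with enumerate P
... | α , covers = (zero Vector.∷ (suc ∘ α)) , λ
  { here → zero , refl
  ; (there x∈P) → suc (proj₁ (covers x∈P)) , cong suc (proj₂ (covers x∈P)) }
enumerate (outside ∷ P) with enumerate P
... | α , covers = (suc ∘ α) , λ { (there x∈P) → proj₁ (covers x∈P) , cong suc (proj₂ (covers x∈P)) }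

injective-⊆-≤ : {n r : ℕ} (P : Subset n) (β : Vector (Fin n) r) →
  Injective _≡_ _≡_ β → (∀ j → β j ∈ P) → r ≤ ∣ P ∣
injective-⊆-≤ P β β-injective inP =
  injective-occurring-≤ (proj₁ (enumerate P)) β β-injective (proj₂ (enumerate P) ∘ inP)

module _ {n : ℕ} (S : Subset n) (v : Fin n) where

  extend-⊆ : S ⊆ S ∪ ⁅ v ⁆
  extend-⊆ = p⊆p∪q ⁅ v ⁆

  extend-new : v ∈ S ∪ ⁅ v ⁆
  extend-new = q⊆p∪q S ⁅ v ⁆ (x∈⁅x⁆ v)

  extend-cases : ∀ {x} → x ∈ S ∪ ⁅ v ⁆ → x ∈ S ⊎ x ≡ v
  extend-cases x∈ with x∈p∪q⁻ S ⁅ v ⁆ x∈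
  ... | inj₁ x∈S = inj₁ x∈S
  ... | inj₂ x∈v = inj₂ (x∈⁅y⁆⇒x≡y v x∈v)

  extend-∉ : ∀ {x} → x ∉ S → x ≢ v → x ∉ S ∪ ⁅ v ⁆
  extend-∉ x∉S x≢v x∈ with extend-cases x∈
  ... | inj₁ x∈S = x∉S x∈S
  ... | inj₂ x≡v = x≢v x≡v

  extend-added : ∀ {x} → x ∉ S → x ∈ S ∪ ⁅ v ⁆ → x ≡ v
  extend-added x∉S x∈ with extend-cases x∈
  ... | inj₁ x∈S = ⊥-elim (x∉S x∈S)
  ... | inj₂ x≡v = x≡v

  extend-⊂ : v ∉ S → S ⊂ S ∪ ⁅ v ⁆
  extend-⊂ v∉S = extend-⊆ , v , extend-new , v∉S

record Biclique {n : ℕ} (G : Graph n) (p q : ℕ) : Set where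
  field
    left            : Vector (Fin n) p
    right           : Vector (Fin n) q
    left-injective  : Injective _≡_ _≡_ left
    right-injective : Injective _≡_ _≡_ right
    disjoint        : ∀ i j → left i ≢ right j
    complete        : ∀ i j → adj G (left i) (right j) ≡ true

  complete′ : ∀ j i → adj G (right j) (left i) ≡ true
  complete′ j i = trans (Graph.sym G (right j) (left i)) (complete i j)

flipBiclique : {n p q : ℕ} {G : Graph n} → Biclique G p q → Biclique G q p
flipBiclique K = record
  { left = right ; right = left
  ; left-injective = right-injective ; right-injective = left-injective
  ; disjoint = λ i j e → disjoint j i (≡-sym e) ; complete = complete′ }
  where open Biclique K

fromContainsKpq : {n p q : ℕ} {G : Graph n} → ContainsKpq G p q → Biclique G p q
fromContainsKpq (f , g , f-injective , g-injective , apart , complete) =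
  record { left = f ; right = g ; left-injective = f-injective ; right-injective = g-injective
         ; disjoint = apart ; complete = complete }

allBut : {n p q : ℕ} {G : Graph n} → Biclique G (suc p) (suc q) →
  Fin (suc p) → Fin (suc q) → Vector (Fin n) (p + q)
allBut K a b = removeAt left a ++ removeAt right b
  where open Biclique K

allBut-injective : {n p q : ℕ} {G : Graph n} (K : Biclique G (suc p) (suc q)) →
  ∀ a b → Injective _≡_ _≡_ (allBut K a b)
allBut-injective K a b =
  ++-injective (removeAt left a) (removeAt right b)
    (removeAt-injective left left-injective a) (removeAt-injective right right-injective b)
    (λ i j → disjoint (punchIn a i) (punchIn b j))
  where open Biclique K

module ForcingChains {n : ℕ} (G : Graph n) (Z : Subset n) where

  Active : Subset n → Fin n → Set
  Active S x = x ∈ S × ∃ λ y → adj G x y ≡ true × y ∉ S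

  record Force (S : Subset n) : Set where
    field
      forcer       : Fin n
      forced       : Fin n
      forcer∈      : forcer ∈ S
      forced∉      : forced ∉ S
      forcer~forced : adj G forcer forced ≡ true
      othersBlack  : ∀ w → adj G forcer w ≡ true → w ≢ forced → w ∈ S

    onlyWhite : ∀ {w} → adj G forcer w ≡ true → w ∉ S → w ≡ forced
    onlyWhite {w} forcer~w w∉S =
      decidable-stable (w ≟ forced) (λ w≢forced → w∉S (othersBlack w forcer~w w≢forced))

    grows : S ⊂ S ∪ ⁅ forced ⁆
    grows = extend-⊂ S forced forced∉

  open Force public

  -- If Z ⊆ S and a vertex outside S is eventually black, some force applies
  -- at S: the first step of its derivation that leaves S.
  forceAvailable : ∀ {S} → Z ⊆ S → ∀ {v} → Black G Z v → v ∉ S → Force S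
  forceAvailable Z⊆S (init v∈Z) v∉S = ⊥-elim (v∉S (Z⊆S v∈Z))
  forceAvailable {S} Z⊆S (force {u} {v} u-black u~v othersEventually) v∉S with u ∈? S
  ... | no u∉S = forceAvailable Z⊆S u-black u∉S
  ... | yes u∈S with Finₚ.any? (λ w → (adj G u w ≟ᵇ true) ×-dec ¬? (w ≟ v) ×-dec ¬? (w ∈? S))
  ...   | yes (w , u~w , w≢v , w∉S) = forceAvailable Z⊆S (othersEventually w u~w w≢v) w∉S
  ...   | no noOtherWhite = record
    { forcer = u ; forced = v ; forcer∈ = u∈S ; forced∉ = v∉S ; forcer~forced = u~v
    ; othersBlack = λ w u~w w≢v →
        decidable-stable (w ∈? S) (λ w∉S → noOtherWhite (w , u~w , w≢v , w∉S)) }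

  -- α lists the current ends of the |Z| forcing chains; every active vertex
  -- is the end of a chain (the other chain vertices have already forced).
  record ChainEnds (S : Subset n) (α : Vector (Fin n) ∣ Z ∣) : Set where
    field
      Z⊆S        : Z ⊆ S
      activeEnds : ∀ {x} → Active S x → x occursIn α

  open ChainEnds public

  activeBound : ∀ {S α r} → ChainEnds S α → (β : Vector (Fin n) r) →
    Injective _≡_ _≡_ β → (∀ j → Active S (β j)) → r ≤ ∣ Z ∣
  activeBound {α = α} ce β β-injective active =
    injective-occurring-≤ α β β-injective (activeEnds ce ∘ active)

  chainEnds-start : ChainEnds Z (proj₁ (enumerate Z))
  chainEnds-start = record { Z⊆S = λ z∈Z → z∈Z ; activeEnds = proj₂ (enumerate Z) ∘ proj₁ }

  -- A force extends the chain ending at the forcer by the forced vertex.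
  chainEnds-step : ∀ {S α} → ChainEnds S α → (F : Force S) →
    Σ (Vector (Fin n) ∣ Z ∣) (ChainEnds (S ∪ ⁅ forced F ⁆))
  chainEnds-step {S} {α} ce F
    with activeEnds ce (forcer∈ F , forced F , forcer~forced F , forced∉ F)
  ... | i , αi≡forcer = updateAt α i (const v) ,
        record { Z⊆S = extend-⊆ S v ∘ Z⊆S ce ; activeEnds = ends }
    where
      v = forced F

      ends : ∀ {x} → Active (S ∪ ⁅ v ⁆) x → x occursIn updateAt α i (const v)
      ends {x} (x∈ , y , x~y , y∉) with extend-cases S v x∈
      ... | inj₂ refl = i , updateAt-updates i α
      ... | inj₁ x∈S with activeEnds ce (x∈S , y , x~y , y∉ ∘ extend-⊆ S v)
      ...   | j , αj≡x with j ≟ i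
      ...     | no j≢i = j , trans (updateAt-minimal j i α j≢i) αj≡x
      ...     | yes refl = ⊥-elim (y∉ (subst (_∈ S ∪ ⁅ v ⁆) (≡-sym y≡v) (extend-new S v)))
        where
          forcer~y : adj G (forcer F) y ≡ true
          forcer~y = subst (λ t → adj G t y ≡ true) (trans (≡-sym αj≡x) αi≡forcer) x~y
          y≡v : y ≡ v
          y≡v = onlyWhite F forcer~y (y∉ ∘ extend-⊆ S v)

module Obstruction {n : ℕ} (G : Graph n) (Z : Subset n) (zf : IsZeroForcingSet G Z) where
  open ForcingChains G Z

  record Setting : Set where
    field
      p q   : ℕ
      K     : Biclique G (suc p) (suc q)
      small : ∣ Z ∣ ≤ suc p ⊓ suc q
      large : ¬ Excluded (suc p) (suc q)

    open Biclique K public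

    exceedsLeft : suc (suc p) ≤ ∣ Z ∣ → ⊥
    exceedsLeft h = ℕₚ.1+n≰n (ℕₚ.≤-trans h (ℕₚ.≤-trans small (ℕₚ.m⊓n≤m (suc p) (suc q))))

    exceedsBoth : p + q ≤ ∣ Z ∣ → ⊥
    exceedsBoth h = large (s≤s p≤1 , s≤s q≤1)
      where
        h′ : p + q ≤ suc p ⊓ suc q
        h′ = ℕₚ.≤-trans h small
        q≤1 : q ≤ 1
        q≤1 = +-≤-suc⇒≤1 p q (ℕₚ.≤-trans h′ (ℕₚ.m⊓n≤m (suc p) (suc q)))
        p≤1 : p ≤ 1
        p≤1 = +-≤-suc⇒≤1 q p
          (subst (_≤ suc q) (ℕₚ.+-comm p q) (ℕₚ.≤-trans h′ (ℕₚ.m⊓n≤n (suc p) (suc q))))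

  swapped : Setting → Setting
  swapped σ = record
    { p = q ; q = p ; K = flipBiclique K
    ; small = subst (∣ Z ∣ ≤_) (ℕₚ.⊓-comm (suc p) (suc q)) small
    ; large = λ { (q≤2 , p≤2) → large (p≤2 , q≤2) } }
    where open Setting σ

  -- Left side black, two right vertices white: the next force (which exists
  -- as Z is zero forcing) is impossible.  A left forcer would have two white
  -- neighbours; any other forcer together with the left side gives 2 + p
  -- active vertices.
  stuck : (σ : Setting) → let open Setting σ in
    ∀ {S α} → ChainEnds S α → (∀ i → left i ∈ S) →
    ∀ {b₁ b₂} → b₁ ≢ b₂ → right b₁ ∉ S → right b₂ ∉ S → ⊥
  stuck σ {S} ce leftBlack {b₁} {b₂} b₁≢b₂ w₁ w₂ =
    noForce (forceAvailable (Z⊆S ce) (zf (right b₁)) w₁)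
    where
      open Setting σ
      noForce : Force S → ⊥
      noForce F with Finₚ.any? (λ i → left i ≟ forcer F)
      ... | yes (i , refl) = b₁≢b₂ (right-injective
              (trans (onlyWhite F (complete i b₁) w₁) (≡-sym (onlyWhite F (complete i b₂) w₂))))
      ... | no forcerNotLeft = exceedsLeft (activeBound ce (forcer F Vector.∷ left)
              (∷-injective (forcer F) left left-injective (λ i e → forcerNotLeft (i , e)))
              λ { zero → forcer∈ F , forced F , forcer~forced F , forced∉ F
                ; (suc i) → leftBlack i , right b₁ , complete i b₁ , w₁ })

  mutual
    -- While both sides keep a white vertex, some side has two white vertices:
    -- otherwise the remaining p + q vertices of K are all active.
    bothSidesWhite : (σ : Setting) → let open Setting σ in
      ∀ {S α} → Acc _⊃_ S → ChainEnds S α → ∀ {a b} → left a ∉ S → right b ∉ S → ⊥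
    bothSidesWhite σ {S} accS ce {a₀} {b₀} wa wb
      with twoFailuresOrAllButOne (λ i → left i ∈? S)
         | twoFailuresOrAllButOne (λ j → right j ∈? S)
      where open Setting σ
    ... | inj₁ (a₁ , a₂ , a₁≢a₂ , w₁ , w₂) | _ =
      forceOnLeft σ accS ce a₁≢a₂ w₁ w₂ wb
    ... | inj₂ _ | inj₁ (b₁ , b₂ , b₁≢b₂ , w₁ , w₂) =
      forceOnLeft (swapped σ) accS ce b₁≢b₂ w₁ w₂ wa
    ... | inj₂ (a , leftBlack) | inj₂ (b , rightBlack) =
      exceedsBoth (activeBound ce (allBut K a b) (allBut-injective K a b)
        (++-all {P = Active S} (removeAt left a) (removeAt right b)
           (λ i → leftBlack i , right b₀ , complete (punchIn a i) b₀ , wb)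
           (λ j → rightBlack j , left a₀ , complete′ (punchIn b j) a₀ , wa)))
      where open Setting σ

    -- Two left vertices and a right vertex are white: apply the next force.
    -- A left vertex stays white; either a right vertex also stays white and
    -- we continue on the strictly larger black set, or the right side has
    -- just become black and we are stuck.
    forceOnLeft : (σ : Setting) → let open Setting σ in
      ∀ {S α} → Acc _⊃_ S → ChainEnds S α →
      ∀ {a₁ a₂ b} → a₁ ≢ a₂ → left a₁ ∉ S → left a₂ ∉ S → right b ∉ S → ⊥
    forceOnLeft σ {S} (acc larger) ce {a₁} {a₂} {b} a₁≢a₂ w₁ w₂ wb =
      afterForce (forceAvailable (Z⊆S ce) (zf (left a₁)) w₁)
      where
        open Setting σ
        afterForce : Force S → ⊥
        afterForce F with chainEnds-step ce F | failureOrAll (λ j → right j ∈? (S ∪ ⁅ forced F ⁆))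
        ... | _ , ce′ | inj₁ (b′ , wb′) with left a₁ ≟ forced F
        ...   | no a₁≢v = bothSidesWhite σ (larger (grows F)) ce′ (extend-∉ S (forced F) w₁ a₁≢v) wb′
        ...   | yes a₁≡v = bothSidesWhite σ (larger (grows F)) ce′
                  (extend-∉ S (forced F) w₂ (λ a₂≡v → a₁≢a₂ (left-injective (trans a₁≡v (≡-sym a₂≡v))))) wb′
        afterForce F | _ , ce′ | inj₂ rightBlack =
          stuck (swapped σ) ce′ rightBlack a₁≢a₂ (stillWhite w₁) (stillWhite w₂)
          where
            b≡v : right b ≡ forced F
            b≡v = extend-added S (forced F) wb (rightBlack b)
            stillWhite : ∀ {a} → left a ∉ S → left a ∉ S ∪ ⁅ forced F ⁆
            stillWhite {a} wa = extend-∉ S (forced F) wa (λ a≡v → disjoint a b (trans a≡v (≡-sym b≡v)))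

  -- At the start the black set is Z.  If the left side lies in Z, then either
  -- two right vertices are white (stuck), or all but one vertex of each side
  -- lies in Z, i.e. p + q ≤ |Z|.
  leftInZ : (σ : Setting) → let open Setting σ in (∀ i → left i ∈ Z) → ⊥
  leftInZ σ leftBlack with twoFailuresOrAllButOne (λ j → right j ∈? Z)
    where open Setting σ
  ... | inj₁ (b₁ , b₂ , b₁≢b₂ , w₁ , w₂) = stuck σ chainEnds-start leftBlack b₁≢b₂ w₁ w₂
  ... | inj₂ (b , rightInZ) = exceedsBoth (injective-⊆-≤ Z (allBut K zero b) (allBut-injective K zero b)
          (++-all {P = _∈ Z} (removeAt left zero) (removeAt right b) (leftBlack ∘ punchIn zero) rightInZ))
    where open Setting σ

  impossible : Setting → ⊥
  impossible σ with failureOrAll (λ i → left i ∈? Z) | failureOrAll (λ j → right j ∈? Z)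
    where open Setting σ
  ... | inj₁ (a , wa) | inj₁ (b , wb) = bothSidesWhite σ (⊃-wellFounded Z) chainEnds-start wa wb
  ... | inj₂ leftBlack | _ = leftInZ σ leftBlack
  ... | inj₁ _ | inj₂ rightBlack = leftInZ (swapped σ) rightBlack

proposition4p34 : {n : ℕ} (G : Graph n) (p q : ℕ) → 1 ≤ p → 1 ≤ q →
    ¬ Excluded p q → ContainsKpq G p q → ZeroForcingNumber≥ G (suc (p ⊓ q))
proposition4p34 G (suc p) (suc q) (s≤s z≤n) (s≤s z≤n) notExcluded K Z zf
  with suc (suc p ⊓ suc q) ≤? ∣ Z ∣
... | yes bigEnough = bigEnough
... | no tooSmall = ⊥-elim (Obstruction.impossible G Z zf record
      { p = p ; q = q ; K = fromContainsKpq K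
      ; small = ℕₚ.≮⇒≥ tooSmall ; large = notExcluded })
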